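{- Let $w\in \mathcal L_{2,\infty}$. (1) If $w=w_0\rho\mu w_1$, then $w'=w_0\mu\rho w_1$ generates the same permutation as $w$, and $w'\prec_\mu w$. (2) If $w=w_0\rho\lambda w_1\lambda\mu w_2$ with $D_{\rho,\lambda}(w_0)=1$ and $w_1\in\mathcal L_{1,\infty}$, then $w'=w_0\lambda\rho w_1\mu\lambda w_2$ generates the same permutation as $w$, and $w'\prec_\mu w$. (3) If $w=w_0\lambda\rho w_1\lambda\mu w_2$ with $D_{\rho,\lambda}(w_0)=1$ and $w_1\in\mathcal L_{1,\infty}$, then $w'=w_0\rho\lambda w_1\mu\lambda w_2$ generates the same permutation as $w$, and $w'\prec_\mu w$.
   Context: Token-passing system: tokens $1,\dots,n$ in an input queue in increasing order, a stack $A$ of capacity $2$ and a stack $B$ of unbounded capacity in series. Move $\rho$: next input token onto top of $A$; $\lambda$: top of $A$ onto top of $B$; $\mu$: top of $B$ to the output. A word $w\in\{\rho,\lambda,\mu\}^*$ generates the permutation $p$ if, starting from all tokens in input and empty stacks, all moves of $w$ are legal and at the end all tokens have been output in the order $p$. For a word $u$ and letters $a,b$, $D_{a,b}(u)$ = (number of $a$'s in $u$) minus (number of $b$'s in $u$). For $k\in\mathbb N$, $\mathcal L_{k,\infty}$ is the set of $w\in\{\rho,\lambda,\mu\}^*$ with $D_{\rho,\lambda}(u)\in[0,k]$ and $D_{\lambda,\mu}(u)\ge0$ for all prefixes $u$ of $w$, and $D_{\rho,\lambda}(w)=D_{\lambda,\mu}(w)=0$. The $\mu$-ordering: let $\theta:\{\rho,\lambda,\mu\}^*\to\{\nu,\mu\}^*$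 be the monoid homomorphism with $\theta(\mu)=\mu$, $\theta(\rho)=\theta(\lambda)=\nu$. For words $u\ne v$, $u\prec_\mu v$ means $|u|=|v|$ and $\theta(u)$ precedes $\theta(v)$ in lexicographic order on $\{\mu,\nu\}^*$ with $\mu<\nu$. -}

module Defs where

open import Data.Nat using (ℕ; zero; suc; _+_; _≤_; _<?_)
open import Data.List using (List; []; _∷_; _++_; length; map; upTo)
open import Data.Maybe using (Maybe; just; nothing)
open import Data.Product using (_×_)
open import Relation.Nullary using (yes; no)
open import Relation.Binary.PropositionalEquality using (_≡_)

-- The three moves: rho = ρ, lam = λ, mu = μ  (λ is reserved in Agda).
data Move : Set where
  rho lam mu : Move

Word : Set
Word = List Move

count : Move → Word → ℕ
count _ [] = 0
count rho (rho ∷ w) = suc (count rho w)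
count rho (_ ∷ w) = count rho w
count lam (lam ∷ w) = suc (count lam w)
count lam (_ ∷ w) = count lam w
count mu (mu ∷ w) = suc (count mu w)
count mu (_ ∷ w) = count mu w

-- Constraints on a single prefix u (D written with ℕ counts):
--   D_{ρ,λ}(u) ∈ [0,k]  ⇔  #λ(u) ≤ #ρ(u) ≤ #λ(u) + k
--   D_{λ,μ}(u) ≥ 0      ⇔  #μ(u) ≤ #λ(u)
PrefixOK : ℕ → Word → Set
PrefixOK k u = (count lam u ≤ count rho u × count rho u ≤ count lam u + k)
               × count mu u ≤ count lam u

InL : ℕ → Word → Set
InL k w = (∀ (u v : Word) → u ++ v ≡ w → PrefixOK k u)
          × (count rho w ≡ count lam w × count lam w ≡ count mu w)

-- Machine state: input queue, stack A (capacity 2, head = top),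
-- stack B (unbounded, head = top), output so far (in output order).
record State : Set where
  constructor st
  field
    input  : List ℕ
    stackA : List ℕ
    stackB : List ℕ
    output : List ℕ

step : Move → State → Maybe State
step rho (st [] A B o) = nothing
step rho (st (x ∷ i) A B o) with length A <? 2
... | yes _ = just (st i (x ∷ A) B o)
... | no _  = nothing
step lam (st i [] B o) = nothing
step lam (st i (x ∷ A) B o) = just (st i A (x ∷ B) o)
step mu (st i A [] o) = nothing
step mu (st i A (x ∷ B) o) = just (st i A B (o ++ (x ∷ [])))

run : Word → State → Maybe State
run [] s = just s
run (m ∷ w) s with step m s
... | nothing = nothing
... | just s' = run w s'

initial : ℕ → State
initial n = st (map suc (upTo n)) [] [] []

Generates : ℕ → Word → List ℕ → Set
Generates n w p = run w (initial n) ≡ just (st [] [] [] p)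

data NM : Set where
  μ' ν' : NM

θ : Word → List NM
θ [] = []
θ (mu ∷ w) = μ' ∷ θ w
θ (rho ∷ w) = ν' ∷ θ w
θ (lam ∷ w) = ν' ∷ θ w

data LexLt : List NM → List NM → Set where
  here : ∀ {xs ys} → LexLt (μ' ∷ xs) (ν' ∷ ys)
  there : ∀ {x xs ys} → LexLt xs ys → LexLt (x ∷ xs) (x ∷ ys)

_≺μ_ : Word → Word → Set
u ≺μ v = length u ≡ length v × LexLt (θ u) (θ v)

SamePerm : Word → Word → Set
SamePerm w w' = ∀ (n : ℕ) (p : List ℕ) → Generates n w p → Generates n w' p

module Submission where

-- For the permutation claims, runs are composed along concatenation (run-++) so
-- that a rewrite of a suffix only has to be justified at the states reached by
-- the prefix w0 (replace-suffix).
--  (1) ρ touches only the input and A, μ only B and the output, so ρμ and μρ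
--      act identically on every state (ρμ-commute).
--  (2),(3) Counting stack heights (heights), #ρ(w0) = #λ(w0) + 1 forces A to hold
--      a single token after w0.  Then ρλ and λρ lead to the same state up to
--      exchanging the token c left in A with the token d on top of B.  A word
--      w1 ∈ L_{1,∞} never reaches below c and d (StaysAbove), so it runs the same
--      way over either arrangement (bottoms-irrelevant) and returns to them
--      (balanced-heights); afterwards λμ and μλ both output c and leave d on B
--      (exchange).

open import Defs
open import Data.Nat using (ℕ; zero; suc; _+_; _≤_; _<_; _<?_; s≤s⁻¹)
open import Data.Nat.Properties using (+-suc; +-cancelʳ-≡; m≢1+n+m)
open import Data.List using (List; []; _∷_; _++_; length)
open import Data.List.Properties using (length-++)
open import Data.Maybe using (just; nothing; _>>=_)
open import Data.Product using (Σ; _×_; _,_; proj₁)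
open import Data.Unit using (⊤; tt)
open import Data.Empty using (⊥; ⊥-elim)
open import Relation.Nullary using (¬_; Dec; yes; no)
open import Relation.Binary.PropositionalEquality
  using (_≡_; refl; sym; trans; cong; subst)

open State

run-++ : ∀ u v s → run (u ++ v) s ≡ (run u s >>= run v)
run-++ [] v s = refl
run-++ (m ∷ u) v s with step m s
... | nothing = refl
... | just s' = run-++ u v s'

run-++-split : ∀ u v s {r} → run (u ++ v) s ≡ just r →
               Σ State λ t → run u s ≡ just t × run v t ≡ just r
run-++-split u v s e with run u s | run-++ u v s
... | just t  | eq = t , refl , trans (sym eq) e
... | nothing | eq with trans (sym eq) e
...   | ()

run-++-join : ∀ u v s {t} → run u s ≡ just t → run (u ++ v) s ≡ run v t
run-++-join u v s {t} e = trans (run-++ u v s) (cong (_>>= run v) e)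

replace-suffix : ∀ w0 {x y s r} →
                 (∀ t → run w0 s ≡ just t → run x t ≡ just r → run y t ≡ just r) →
                 run (w0 ++ x) s ≡ just r → run (w0 ++ y) s ≡ just r
replace-suffix w0 {x} {y} {s} replace e with run-++-split w0 x s e
... | t , e₀ , e₁ = trans (run-++-join w0 y s e₀) (replace t e₀ e₁)

rho-legal : ∀ w x i A B o → length A < 2 → run (rho ∷ w) (st (x ∷ i) A B o) ≡ run w (st i (x ∷ A) B o)
rho-legal w x i A B o fits with length A <? 2
... | yes _ = refl
... | no full = ⊥-elim (full fits)

rho-illegal : ∀ w x i A B o → ¬ length A < 2 → run (rho ∷ w) (st (x ∷ i) A B o) ≡ nothing
rho-illegal w x i A B o full with length A <? 2
... | yes fits = ⊥-elim (full fits)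
... | no _ = refl

-- ρ acts on the input and A, μ on B and the output: the two moves commute.
ρμ-commute : ∀ w s → run (rho ∷ mu ∷ w) s ≡ run (mu ∷ rho ∷ w) s
ρμ-commute w (st [] A [] o) = refl
ρμ-commute w (st [] A (y ∷ B) o) = refl
ρμ-commute w (st (x ∷ i) A [] o) with length A <? 2
... | yes _ = refl
... | no _ = refl
ρμ-commute w (st (x ∷ i) A (y ∷ B) o) = commute (length A <? 2)
  where
  commute : Dec (length A < 2) → run (rho ∷ mu ∷ w) (st (x ∷ i) A (y ∷ B) o)
                                ≡ run (mu ∷ rho ∷ w) (st (x ∷ i) A (y ∷ B) o)
  commute (yes fits) = trans (rho-legal (mu ∷ w) x i A (y ∷ B) o fits)
                             (sym (rho-legal w x i A B (o ++ y ∷ []) fits))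
  commute (no full) = trans (rho-illegal (mu ∷ w) x i A (y ∷ B) o full)
                            (sym (rho-illegal w x i A B (o ++ y ∷ []) full))

-- Stack heights: ρ pushes onto A, λ moves from A to B, μ pops B.
heights : ∀ w s {t} → run w s ≡ just t →
          length (stackA t) + count lam w ≡ length (stackA s) + count rho w
          × length (stackB t) + count mu w ≡ length (stackB s) + count lam w
heights [] s refl = refl , refl
heights (rho ∷ w) (st [] A B o) ()
heights (rho ∷ w) (st (x ∷ i) A B o) e with length A <? 2
... | no _ with e
...   | ()
heights (rho ∷ w) (st (x ∷ i) A B o) e | yes _ with heights w (st i (x ∷ A) B o) e
...   | hA , hB = trans hA (sym (+-suc (length A) (count rho w))) , hB
heights (lam ∷ w) (st i [] B o) ()
heights (lam ∷ w) (st i (x ∷ A) B o) e with heights w (st i A (x ∷ B) o) e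
... | hA , hB = trans (+-suc _ (count lam w)) (cong suc hA)
              , trans hB (sym (+-suc (length B) (count lam w)))
heights (mu ∷ w) (st i A [] o) ()
heights (mu ∷ w) (st i A (x ∷ B) o) e with heights w (st i A B (o ++ x ∷ [])) e
... | hA , hB = hA , trans (+-suc _ (count mu w)) (cong suc hB)

one-token-in-A : ∀ w0 {n t} → count rho w0 ≡ suc (count lam w0) →
                 run w0 (initial n) ≡ just t → Σ ℕ λ a → stackA t ≡ a ∷ []
one-token-in-A w0 {t = t} c e =
  singleton (stackA t) (+-cancelʳ-≡ (count lam w0) _ 1 (trans (proj₁ (heights w0 _ e)) c))
  where
  singleton : ∀ (xs : List ℕ) → length xs ≡ 1 → Σ ℕ λ a → xs ≡ a ∷ []
  singleton (a ∷ []) _ = a , refl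

balanced-heights : ∀ w s {t} → count rho w ≡ count lam w → count lam w ≡ count mu w →
                   run w s ≡ just t →
                   length (stackA t) ≡ length (stackA s) × length (stackB t) ≡ length (stackB s)
balanced-heights w s bal₁ bal₂ e with heights w s e
... | hA , hB = +-cancelʳ-≡ (count lam w) _ _ (trans hA (cong (length (stackA s) +_) bal₁))
              , +-cancelʳ-≡ (count mu w) _ _ (trans hB (cong (length (stackB s) +_) bal₂))

plug : List ℕ → List ℕ → State → State
plug Ab Bb (st i A B o) = st i (A ++ Ab) (B ++ Bb) o

-- StaysAbove nA nB w: started with nA usable tokens on A and nB on B, w never pops below them.
-- This is the letter-by-letter form of PrefixBounded nA nB w.
StaysAbove : ℕ → ℕ → Word → Set
StaysAbove _ _ [] = ⊤
StaysAbove nA nB (rho ∷ w) = StaysAbove (suc nA) nB w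
StaysAbove zero _ (lam ∷ _) = ⊥
StaysAbove (suc nA) nB (lam ∷ w) = StaysAbove nA (suc nB) w
StaysAbove _ zero (mu ∷ _) = ⊥
StaysAbove nA (suc nB) (mu ∷ w) = StaysAbove nA nB w

-- Every prefix u has D_{λ,ρ}(u) ≤ nA and D_{μ,λ}(u) ≤ nB: the prefix conditions of L_{k,∞}
-- relative to starting stacks of heights nA and nB.
PrefixBounded : ℕ → ℕ → Word → Set
PrefixBounded nA nB w =
  ∀ u v → u ++ v ≡ w → count lam u ≤ nA + count rho u × count mu u ≤ nB + count lam u

prefix-bounded⇒stays-above : ∀ nA nB w → PrefixBounded nA nB w → StaysAbove nA nB w
prefix-bounded⇒stays-above nA nB [] _ = tt
prefix-bounded⇒stays-above nA nB (rho ∷ w) h =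
  prefix-bounded⇒stays-above (suc nA) nB w λ u v e →
    let (lamBound , muBound) = h (rho ∷ u) v (cong (rho ∷_) e)
    in subst (count lam u ≤_) (+-suc nA (count rho u)) lamBound , muBound
prefix-bounded⇒stays-above zero nB (lam ∷ w) h with h (lam ∷ []) w refl
... | () , _
prefix-bounded⇒stays-above (suc nA) nB (lam ∷ w) h =
  prefix-bounded⇒stays-above nA (suc nB) w λ u v e →
    let (lamBound , muBound) = h (lam ∷ u) v (cong (lam ∷_) e)
    in s≤s⁻¹ lamBound , subst (count mu u ≤_) (+-suc nB (count lam u)) muBound
prefix-bounded⇒stays-above nA zero (mu ∷ w) h with h (mu ∷ []) w refl
... | _ , ()
prefix-bounded⇒stays-above nA (suc nB) (mu ∷ w) h =
  prefix-bounded⇒stays-above nA nB w λ u v e →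
    let (lamBound , muBound) = h (mu ∷ u) v (cong (mu ∷_) e)
    in lamBound , s≤s⁻¹ muBound

L1⇒stays-above : ∀ w → InL 1 w → StaysAbove 0 0 w
L1⇒stays-above w (prefixOK , _) =
  prefix-bounded⇒stays-above 0 0 w λ u v e →
    let ((lamBound , _) , muBound) = prefixOK u v e in lamBound , muBound

-- The bottoms under a run that stays above them are irrelevant: the same word succeeds
-- with any other bottoms (of the same length for A, whose capacity is bounded) and ends
-- in the same state with the bottoms exchanged.
bottoms-irrelevant : ∀ w s {Ab Ab' Bb Bb' r} → length Ab ≡ length Ab' →
                     StaysAbove (length (stackA s)) (length (stackB s)) w →
                     run w (plug Ab Bb s) ≡ just r →
                     Σ State λ t → r ≡ plug Ab Bb t × run w (plug Ab' Bb' s) ≡ just (plug Ab' Bb' t)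
bottoms-irrelevant [] s _ _ refl = s , refl , refl
bottoms-irrelevant (rho ∷ w) (st [] A B o) _ _ ()
bottoms-irrelevant (rho ∷ w) (st (x ∷ i) A B o) {Ab} {Ab'} sameLength above e
  with length (A ++ Ab) <? 2 | length (A ++ Ab') <? 2
... | yes _ | yes _ = bottoms-irrelevant w (st i (x ∷ A) B o) sameLength above e
... | yes fits | no ¬fits = ⊥-elim (¬fits (subst (_< 2) sameHeight fits))
  where
  sameHeight : length (A ++ Ab) ≡ length (A ++ Ab')
  sameHeight = trans (length-++ A) (trans (cong (length A +_) sameLength) (sym (length-++ A)))
... | no _ | _ with e
...   | ()
bottoms-irrelevant (lam ∷ w) (st i [] B o) _ ()
bottoms-irrelevant (lam ∷ w) (st i (x ∷ A) B o) sameLength above e =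
  bottoms-irrelevant w (st i A (x ∷ B) o) sameLength above e
bottoms-irrelevant (mu ∷ w) (st i A [] o) _ ()
bottoms-irrelevant (mu ∷ w) (st i A (x ∷ B) o) sameLength above e =
  bottoms-irrelevant w (st i A B (o ++ x ∷ [])) sameLength above e

no-top : ∀ (xs ys : List ℕ) → length (xs ++ ys) ≡ length ys → xs ≡ []
no-top [] ys _ = refl
no-top (x ∷ xs) ys e = ⊥-elim (m≢1+n+m (length ys) (sym (trans (cong suc (sym (length-++ xs))) e)))

-- The exchange behind parts (2) and (3): with one token c in A and d on top of B, running
-- w1 λμ equals running w1 μλ with c and d interchanged, for w1 ∈ L_{1,∞}.  Indeed w1 runs
-- above c and d and returns to empty tops, after which λμ and μλ both output c and leave d on B.
exchange : ∀ w1 w2 → InL 1 w1 → ∀ i c d B o {r} →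
           run (w1 ++ lam ∷ mu ∷ w2) (st i (c ∷ []) (d ∷ B) o) ≡ just r →
           run (w1 ++ mu ∷ lam ∷ w2) (st i (d ∷ []) (c ∷ B) o) ≡ just r
exchange w1 w2 h@(_ , bal₁ , bal₂) i c d B o e
  with run-++-split w1 (lam ∷ mu ∷ w2) _ e
... | t₁ , e₁ , e₂
  with bottoms-irrelevant w1 (st i [] [] o) {c ∷ []} {d ∷ []} {d ∷ B} {c ∷ B}
         refl (L1⇒stays-above w1 h) e₁
... | st i' A' B' o' , refl , e₁'
  with balanced-heights w1 _ bal₁ bal₂ e₁
... | sameA , sameB
  with no-top A' (c ∷ []) sameA | no-top B' (d ∷ B) sameB
... | refl | refl = trans (run-++-join w1 (mu ∷ lam ∷ w2) _ e₁') e₂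

-- Part (2) at the state after w0, where A holds the single token a: both ρλ and λρ
-- push the next input token x, and lead to the two sides of exchange with c = a, d = x.
ρλ-to-λρ : ∀ w1 w2 → InL 1 w1 → ∀ {r} i a B o →
           run (rho ∷ lam ∷ w1 ++ lam ∷ mu ∷ w2) (st i (a ∷ []) B o) ≡ just r →
           run (lam ∷ rho ∷ w1 ++ mu ∷ lam ∷ w2) (st i (a ∷ []) B o) ≡ just r
ρλ-to-λρ w1 w2 h [] a B o ()
ρλ-to-λρ w1 w2 h (x ∷ i) a B o e = exchange w1 w2 h i a x B o e

-- Part (3) likewise, now with c = x and d = a.
λρ-to-ρλ : ∀ w1 w2 → InL 1 w1 → ∀ {r} i a B o →
           run (lam ∷ rho ∷ w1 ++ lam ∷ mu ∷ w2) (st i (a ∷ []) B o) ≡ just r →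
           run (rho ∷ lam ∷ w1 ++ mu ∷ lam ∷ w2) (st i (a ∷ []) B o) ≡ just r
λρ-to-ρλ w1 w2 h [] a B o ()
λρ-to-ρλ w1 w2 h (x ∷ i) a B o e = exchange w1 w2 h i x a B o e

after-one-token : ∀ w0 {x y n r} → count rho w0 ≡ suc (count lam w0) →
                  (∀ i a B o → run x (st i (a ∷ []) B o) ≡ just r → run y (st i (a ∷ []) B o) ≡ just r) →
                  run (w0 ++ x) (initial n) ≡ just r → run (w0 ++ y) (initial n) ≡ just r
after-one-token w0 {x} {y} {n} {r} c replace = replace-suffix w0 replaceAfter
  where
  replaceAfter : ∀ t → run w0 (initial n) ≡ just t → run x t ≡ just r → run y t ≡ just r
  replaceAfter (st i A B o) e₀ with one-token-in-A w0 c e₀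
  ... | a , refl = replace i a B o

θ-letter : Move → NM
θ-letter mu = μ'
θ-letter rho = ν'
θ-letter lam = ν'

θ-∷ : ∀ a v → θ (a ∷ v) ≡ θ-letter a ∷ θ v
θ-∷ mu v = refl
θ-∷ rho v = refl
θ-∷ lam v = refl

≺μ-cons : ∀ a b v v' → θ-letter a ≡ θ-letter b → v ≺μ v' → (a ∷ v) ≺μ (b ∷ v')
≺μ-cons a b v v' sameImage (sameLength , smaller)
  rewrite θ-∷ a v | θ-∷ b v' | sameImage = cong suc sameLength , there smaller

≺μ-prefix : ∀ u v v' → v ≺μ v' → (u ++ v) ≺μ (u ++ v')
≺μ-prefix [] v v' smaller = smaller
≺μ-prefix (a ∷ u) v v' smaller = ≺μ-cons a a (u ++ v) (u ++ v') refl (≺μ-prefix u v v' smaller)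

μ-first : ∀ a v v' → θ-letter a ≡ ν' → length v ≡ length v' → (mu ∷ v) ≺μ (a ∷ v')
μ-first a v v' isν sameLength rewrite θ-∷ a v' | isν = cong suc sameLength , here

≺μ-exchange : ∀ w0 w1 w2 a b → θ-letter a ≡ ν' → θ-letter b ≡ ν' →
              (w0 ++ (b ∷ a ∷ w1 ++ (mu ∷ lam ∷ w2))) ≺μ (w0 ++ (a ∷ b ∷ w1 ++ (lam ∷ mu ∷ w2)))
≺μ-exchange w0 w1 w2 a b aν bν =
  ≺μ-prefix w0 (b ∷ a ∷ w1 ++ mu ∷ lam ∷ w2) (a ∷ b ∷ w1 ++ lam ∷ mu ∷ w2)
    (≺μ-cons b a (a ∷ w1 ++ mu ∷ lam ∷ w2) (b ∷ w1 ++ lam ∷ mu ∷ w2) (trans bν (sym aν))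
      (≺μ-cons a b (w1 ++ mu ∷ lam ∷ w2) (w1 ++ lam ∷ mu ∷ w2) (trans aν (sym bν))
        (≺μ-prefix w1 (mu ∷ lam ∷ w2) (lam ∷ mu ∷ w2)
          (μ-first lam (lam ∷ w2) (mu ∷ w2) refl refl))))

swap-ρμ : (w w0 w1 : Word) → InL 2 w →
        w ≡ w0 ++ (rho ∷ mu ∷ w1) →
        SamePerm w (w0 ++ (mu ∷ rho ∷ w1)) × (w0 ++ (mu ∷ rho ∷ w1)) ≺μ w
swap-ρμ w w0 w1 _ refl =
  (λ _ _ → replace-suffix w0 λ t _ e → trans (sym (ρμ-commute w1 t)) e)
  , ≺μ-prefix w0 (mu ∷ rho ∷ w1) (rho ∷ mu ∷ w1) (μ-first rho (rho ∷ w1) (mu ∷ w1) refl refl)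

-- Part (2): ρλ w1 λμ ↦ λρ w1 μλ, valid because A holds one token after w0.
swap-ρλ : (w w0 w1 w2 : Word) → InL 2 w →
        w ≡ w0 ++ (rho ∷ lam ∷ w1 ++ (lam ∷ mu ∷ w2)) →
        count rho w0 ≡ suc (count lam w0) → InL 1 w1 →
        SamePerm w (w0 ++ (lam ∷ rho ∷ w1 ++ (mu ∷ lam ∷ w2)))
          × (w0 ++ (lam ∷ rho ∷ w1 ++ (mu ∷ lam ∷ w2))) ≺μ w
swap-ρλ w w0 w1 w2 _ refl oneToken w1∈L1 =
  (λ _ _ → after-one-token w0 oneToken (ρλ-to-λρ w1 w2 w1∈L1))
  , ≺μ-exchange w0 w1 w2 rho lam refl refl

swap-λρ : (w w0 w1 w2 : Word) → InL 2 w →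
        w ≡ w0 ++ (lam ∷ rho ∷ w1 ++ (lam ∷ mu ∷ w2)) →
        count rho w0 ≡ suc (count lam w0) → InL 1 w1 →
        SamePerm w (w0 ++ (rho ∷ lam ∷ w1 ++ (mu ∷ lam ∷ w2)))
          × (w0 ++ (rho ∷ lam ∷ w1 ++ (mu ∷ lam ∷ w2))) ≺μ w
swap-λρ w w0 w1 w2 _ refl oneToken w1∈L1 =
  (λ _ _ → after-one-token w0 oneToken (λρ-to-ρλ w1 w2 w1∈L1))
  , ≺μ-exchange w0 w1 w2 lam rho refl refl

lemma3p5 :
    ((w w0 w1 : Word) → InL 2 w →
        w ≡ w0 ++ (rho ∷ mu ∷ w1) →
        SamePerm w (w0 ++ (mu ∷ rho ∷ w1)) × (w0 ++ (mu ∷ rho ∷ w1)) ≺μ w)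
    × ((w w0 w1 w2 : Word) → InL 2 w →
        w ≡ w0 ++ (rho ∷ lam ∷ w1 ++ (lam ∷ mu ∷ w2)) →
        count rho w0 ≡ suc (count lam w0) → InL 1 w1 →
        SamePerm w (w0 ++ (lam ∷ rho ∷ w1 ++ (mu ∷ lam ∷ w2)))
          × (w0 ++ (lam ∷ rho ∷ w1 ++ (mu ∷ lam ∷ w2))) ≺μ w)
    × ((w w0 w1 w2 : Word) → InL 2 w →
        w ≡ w0 ++ (lam ∷ rho ∷ w1 ++ (lam ∷ mu ∷ w2)) →
        count rho w0 ≡ suc (count lam w0) → InL 1 w1 →
        SamePerm w (w0 ++ (rho ∷ lam ∷ w1 ++ (mu ∷ lam ∷ w2)))
          × (w0 ++ (rho ∷ lam ∷ w1 ++ (mu ∷ lam ∷ w2))) ≺μ w)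
lemma3p5 = swap-ρμ , swap-ρλ , swap-λρ
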